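{- Let $p$ be a prime and let $h,a$ be integers with $1\le h,a\le p-1$ and $\gcd(h,a,p-1)=1$. Then $h^{h}\equiv a^{a}\pmod p$ holds if and only if there exists an integer $g$ with $1\le g\le p-1$ such that $g^{h}\equiv a\pmod p$ and $g^{a}\equiv h\pmod p$; moreover, in that case such $g$ is unique. Consequently, there is a one-to-one correspondence between triples $(g,h,a)$ satisfying $g^{h}\equiv a$, $g^{a}\equiv h \pmod p$ and pairs $(h,a)$ satisfying $h^h\equiv a^a\pmod p$, restricted to those with $\gcd(h,a,p-1)=1$. In particular, this holds whenever $\gcd(h,p-1)=1$ or $\gcd(a,p-1)=1$.
   Context: All integers $g,h,a$ are taken in the range $1,\dots,p-1$. -}

module Defs where

open import Data.Nat using (ℕ; zero; suc)
open import Data.Nat.DivMod using (_%_)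
open import Relation.Binary.PropositionalEquality using (_≡_)

infix 4 _≡_[mod_]
_≡_[mod_] : ℕ → ℕ → ℕ → Set
a ≡ b [mod zero ] = a ≡ b
a ≡ b [mod suc n ] = a % suc n ≡ b % suc n

{-# OPTIONS --safe #-}

-- Since gcd (h, a, p − 1) = 1 there are u, v with u h + v a ≡ 1 (mod p − 1), so by
-- Fermat x ^ (u h + v a) ≡ x for every x prime to p.  Any solution g of g ^ h ≡ a,
-- g ^ a ≡ h is therefore g ≡ (g ^ h) ^ u (g ^ a) ^ v ≡ a ^ u h ^ v, which gives
-- uniqueness.  Conversely, if h ^ h ≡ a ^ a then g = a ^ u h ^ v is a solution:
-- g ^ h ≡ (a ^ h) ^ u (h ^ h) ^ v ≡ (a ^ h) ^ u (a ^ a) ^ v ≡ a, and symmetrically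
-- g ^ a ≡ h.  That a solution forces h ^ h ≡ (g ^ a) ^ h = (g ^ h) ^ a ≡ a ^ a is
-- immediate.

module Submission where

open import Defs
open import Data.Nat.Base
  using (ℕ; zero; suc; _+_; _*_; _∸_; _^_; _!; _≤_; _<_; z<s; s≤s; >-nonZero; +-*-rawSemiring)
import Data.Nat.Properties as ℕₚ
open import Algebra.Properties.CommutativeSemigroup ℕₚ.+-commutativeSemigroup using (x∙yz≈y∙xz)
import Algebra.Properties.CommutativeSemiring.Binomial ℕₚ.+-*-commutativeSemiring as Binomial
import Algebra.Properties.CommutativeSemiring.Exp ℕₚ.+-*-commutativeSemiring as SemiringExp
import Algebra.Definitions.RawSemiring +-*-rawSemiring as Semiring
open import Algebra.Properties.Monoid.Sum ℕₚ.+-0-monoid using (sum; sum-init-last; sum-cong-≗)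
open import Data.Fin.Base using (toℕ; fromℕ) renaming (zero to fzero; suc to fsuc)
open import Data.Fin.Properties using (toℕ-fromℕ; inject₁ℕ<)
open import Data.List.Base using (_∷_; [])
open import Data.Nat.Combinatorics using (_C_; nCk≡n!/k![n-k]!; k![n∸k]!∣n!; nCn≡1)
open import Data.Nat.DivMod
  using (_%_; _/_; m≡m%n+[m/n]*n; m%n%n≡m%n; m%n<n; m≤n⇒m%n≡m; m/n*n≡m;
         %-distribˡ-+; %-distribˡ-*; %-remove-+ˡ; %-remove-+ʳ)
open import Data.Nat.Divisibility
  using (_∣_; _∤_; divides; _∣0; ∣1⇒≡1; ∣⇒≤; >⇒∤; m%n≡0⇒n∣m; m∣m*n; n∣m*n; ∣m⇒∣m*n; ∣m∣n⇒∣m+n)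
open import Data.Nat.GCD using (gcd; gcd-GCD; module Bézout)
open import Data.Nat.Primality using (Prime; euclidsLemma; ¬prime[0]; ¬prime[1])
open import Data.Nat.Properties
  using (_!*_!≢0; ≤-total; <-trans; <⇒≤; n<1+n; <⇒≱; m<1+n⇒m≤n; m∸n≤m; n∸n≡0; m∸n+n≡m;
         [m+n]∸[m+o]≡n∸o; +-comm; *-comm; *-identityˡ; *-identityʳ; *-distribʳ-∸; *-distribˡ-∸;
         ^-zeroˡ; ^-distribˡ-+-*; ^-*-assoc)
open import Data.Nat.Tactic.RingSolver using (solve)
open import Data.Product using (Σ; _×_; _,_; proj₁; proj₂; ∃₂)
open import Data.Empty using (⊥-elim)
open import Data.Sum using ([_,_]′)
open import Data.Vec.Functional using (Vector; head; tail; init; last)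
open import Function using (_∘_; id)
open import Relation.Nullary using (contradiction)
open import Relation.Binary.PropositionalEquality
  using (_≡_; refl; sym; trans; cong; cong₂; subst; module ≡-Reasoning)

+-cong-mod : ∀ {n a b c d} → a ≡ b [mod suc n ] → c ≡ d [mod suc n ] → a + c ≡ b + d [mod suc n ]
+-cong-mod {n} {a} {b} {c} {d} a≡b c≡d = begin
  (a + c) % suc n                 ≡⟨ %-distribˡ-+ a c (suc n) ⟩
  (a % suc n + c % suc n) % suc n ≡⟨ cong₂ (λ x y → (x + y) % suc n) a≡b c≡d ⟩
  (b % suc n + d % suc n) % suc n ≡⟨ %-distribˡ-+ b d (suc n) ⟨
  (b + d) % suc n                 ∎
  where open ≡-Reasoning

*-cong-mod : ∀ {n a b c d} → a ≡ b [mod suc n ] → c ≡ d [mod suc n ] → a * c ≡ b * d [mod suc n ]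
*-cong-mod {n} {a} {b} {c} {d} a≡b c≡d = begin
  a * c % suc n                     ≡⟨ %-distribˡ-* a c (suc n) ⟩
  (a % suc n) * (c % suc n) % suc n ≡⟨ cong₂ (λ x y → x * y % suc n) a≡b c≡d ⟩
  (b % suc n) * (d % suc n) % suc n ≡⟨ %-distribˡ-* b d (suc n) ⟨
  b * d % suc n                     ∎
  where open ≡-Reasoning

^-congˡ-mod : ∀ {n a b} → a ≡ b [mod suc n ] → ∀ k → a ^ k ≡ b ^ k [mod suc n ]
^-congˡ-mod             a≡b zero    = refl
^-congˡ-mod {n} {a} {b} a≡b (suc k) =
  *-cong-mod {n} {a} {b} {a ^ k} {b ^ k} a≡b (^-congˡ-mod a≡b k)

≡-mod⇒∣∸ : ∀ {n a b} → a ≡ b [mod suc n ] → suc n ∣ a ∸ b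
≡-mod⇒∣∸ {n} {a} {b} a≡b = divides (a / suc n ∸ b / suc n) (begin
  a ∸ b
    ≡⟨ cong₂ _∸_ (m≡m%n+[m/n]*n a (suc n)) (m≡m%n+[m/n]*n b (suc n)) ⟩
  (a % suc n + a / suc n * suc n) ∸ (b % suc n + b / suc n * suc n)
    ≡⟨ cong (λ r → (a % suc n + a / suc n * suc n) ∸ (r + b / suc n * suc n)) a≡b ⟨
  (a % suc n + a / suc n * suc n) ∸ (a % suc n + b / suc n * suc n)
    ≡⟨ [m+n]∸[m+o]≡n∸o (a % suc n) _ _ ⟩
  a / suc n * suc n ∸ b / suc n * suc n
    ≡⟨ *-distribʳ-∸ (suc n) (a / suc n) (b / suc n) ⟨
  (a / suc n ∸ b / suc n) * suc n
    ∎)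
  where open ≡-Reasoning

∣∸⇒≡-mod : ∀ {n a b} → b ≤ a → suc n ∣ a ∸ b → a ≡ b [mod suc n ]
∣∸⇒≡-mod {n} {a} {b} b≤a n∣a∸b = begin
  a % suc n           ≡⟨ cong (_% suc n) (m∸n+n≡m b≤a) ⟨
  (a ∸ b + b) % suc n ≡⟨ %-remove-+ˡ b n∣a∸b ⟩
  b % suc n           ∎
  where open ≡-Reasoning

≡-mod⇒≡ : ∀ {n x y} → x ≤ n → y ≤ n → x ≡ y [mod suc n ] → x ≡ y
≡-mod⇒≡ x≤n y≤n x≡y = trans (sym (m≤n⇒m%n≡m x≤n)) (trans x≡y (m≤n⇒m%n≡m y≤n))

*-cancelˡ-mod : ∀ {n x y z} → Prime (suc n) → suc n ∤ x →
                x * y ≡ x * z [mod suc n ] → y ≡ z [mod suc n ]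
*-cancelˡ-mod {n} {x} {y} {z} p-prime p∤x xy≡xz =
  [ (λ z≤y → cancel {y} {z} z≤y xy≡xz) , (λ y≤z → sym (cancel {z} {y} y≤z (sym xy≡xz))) ]′ (≤-total z y)
  where
  cancel : ∀ {y z} → z ≤ y → x * y ≡ x * z [mod suc n ] → y ≡ z [mod suc n ]
  cancel {y} {z} z≤y xy≡xz = ∣∸⇒≡-mod z≤y
    ([ ⊥-elim ∘ p∤x , id ]′ (euclidsLemma x (y ∸ z) p-prime
      (subst (suc n ∣_) (sym (*-distribˡ-∸ x y z)) (≡-mod⇒∣∸ {n} {x * y} {x * z} xy≡xz))))

Semiring-^≡^ : ∀ x n → x Semiring.^ n ≡ x ^ n
Semiring-^≡^ x zero    = refl
Semiring-^≡^ x (suc n) = cong (x *_) (Semiring-^≡^ x n)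

Semiring-×≡* : ∀ n x → n Semiring.× x ≡ n * x
Semiring-×≡* zero    x = refl
Semiring-×≡* (suc n) x = cong (x +_) (Semiring-×≡* n x)

^-distribʳ-* : ∀ x y n → (x * y) ^ n ≡ x ^ n * y ^ n
^-distribʳ-* x y n = begin
  (x * y) ^ n                     ≡⟨ Semiring-^≡^ (x * y) n ⟨
  (x * y) Semiring.^ n            ≡⟨ SemiringExp.^-distrib-* x y n ⟩
  x Semiring.^ n * y Semiring.^ n ≡⟨ cong₂ _*_ (Semiring-^≡^ x n) (Semiring-^≡^ y n) ⟩
  x ^ n * y ^ n                   ∎
  where open ≡-Reasoning

[x^m]^n≡x^[n*m] : ∀ x m n → (x ^ m) ^ n ≡ x ^ (n * m)
[x^m]^n≡x^[n*m] x m n = trans (^-*-assoc x m n) (cong (x ^_) (*-comm m n))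

[x^m]^n≡[x^n]^m : ∀ x m n → (x ^ m) ^ n ≡ (x ^ n) ^ m
[x^m]^n≡[x^n]^m x m n =
  trans ([x^m]^n≡x^[n*m] x m n) (trans (cong (x ^_) (*-comm n m)) (sym ([x^m]^n≡x^[n*m] x n m)))

x^[u*e+v*f]≡[x^e]^u*[x^f]^v : ∀ x u v e f → x ^ (u * e + v * f) ≡ (x ^ e) ^ u * (x ^ f) ^ v
x^[u*e+v*f]≡[x^e]^u*[x^f]^v x u v e f = trans (^-distribˡ-+-* x (u * e) (v * f))
  (sym (cong₂ _*_ ([x^m]^n≡x^[n*m] x e u) ([x^m]^n≡x^[n*m] x f v)))

[y^u*z^v]^e≡[y^e]^u*[z^e]^v : ∀ y z u v e → (y ^ u * z ^ v) ^ e ≡ (y ^ e) ^ u * (z ^ e) ^ v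
[y^u*z^v]^e≡[y^e]^u*[z^e]^v y z u v e =
  trans (^-distribʳ-* (y ^ u) (z ^ v) e) (cong₂ _*_ ([x^m]^n≡[x^n]^m y u e) ([x^m]^n≡[x^n]^m z v e))

binomial-theorem : ∀ x y n →
  (x + y) ^ n ≡ sum {suc n} (λ k → (n C toℕ k) * (x ^ toℕ k * y ^ (n ∸ toℕ k)))
binomial-theorem x y n = begin
  (x + y) ^ n                       ≡⟨ Semiring-^≡^ (x + y) n ⟨
  (x + y) Semiring.^ n              ≡⟨ Binomial.theorem n x y ⟩
  sum (Binomial.binomialTerm x y n) ≡⟨ sum-cong-≗ {suc n} term ⟩
  sum {suc n} (λ k → (n C toℕ k) * (x ^ toℕ k * y ^ (n ∸ toℕ k))) ∎
  where
  open ≡-Reasoning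
  term : ∀ k → Binomial.binomialTerm x y n k ≡ (n C toℕ k) * (x ^ toℕ k * y ^ (n ∸ toℕ k))
  term k = trans (Semiring-×≡* (n C toℕ k) _)
    (cong ((n C toℕ k) *_) (cong₂ _*_ (Semiring-^≡^ x (toℕ k)) (Semiring-^≡^ y (n ∸ toℕ k))))

∣-sum : ∀ {d n} (t : Vector ℕ n) → (∀ i → d ∣ t i) → d ∣ sum t
∣-sum {d} {zero}  t d∣t = d ∣0
∣-sum {d} {suc n} t d∣t = ∣m∣n⇒∣m+n (d∣t fzero) (∣-sum (tail t) (d∣t ∘ fsuc))

prime∤! : ∀ {p m} → Prime p → m < p → p ∤ m !
prime∤! {m = zero}  p-prime _   p∣1 = ¬prime[1] (subst Prime (∣1⇒≡1 p∣1) p-prime)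
prime∤! {m = suc m} p-prime m<p p∣m! =
  [ <⇒≱ m<p ∘ ∣⇒≤ , prime∤! p-prime (<-trans (n<1+n m) m<p) ]′ (euclidsLemma (suc m) (m !) p-prime p∣m!)

-- p divides p! = k! (p − k)! · C(p, k) but neither factorial.
prime∣C : ∀ {n k} → Prime (suc n) → k < n → suc n ∣ suc n C suc k
prime∣C {n} {k} p-prime k<n =
  [ id , ⊥-elim ∘ [ prime∤! p-prime (s≤s k<n) , prime∤! p-prime (s≤s (m∸n≤m n k)) ]′ ∘ euclidsLemma _ _ p-prime ]′
    (euclidsLemma (p C suc k) d p-prime (subst (p ∣_) p!≡C*d (m∣m*n (n !))))
  where
  open ≡-Reasoning
  p d : ℕ
  p = suc n
  d = suc k ! * (p ∸ suc k) !
  instance _ = suc k !* (p ∸ suc k) !≢0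
  p!≡C*d : p ! ≡ (p C suc k) * d
  p!≡C*d = begin
    p !             ≡⟨ m/n*n≡m (k![n∸k]!∣n! (s≤s (<⇒≤ k<n))) ⟨
    (p ! / d) * d   ≡⟨ cong (_* d) (nCk≡n!/k![n-k]! (s≤s (<⇒≤ k<n))) ⟨
    (p C suc k) * d ∎

freshmans-dream : ∀ {n} → Prime (suc n) → ∀ x → (x + 1) ^ suc n ≡ 1 + x ^ suc n [mod suc n ]
freshmans-dream {n} p-prime x = begin
  (x + 1) ^ p % p                                      ≡⟨ cong (_% p) (binomial-theorem x 1 p) ⟩
  (head t + sum (tail t)) % p                          ≡⟨ cong (λ s → (head t + s) % p) (sum-init-last (tail t)) ⟩
  (head t + (sum (init (tail t)) + last (tail t))) % p ≡⟨ cong₂ (λ y z → (y + (sum (init (tail t)) + z)) % p) head-t last-t ⟩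
  (1 + (sum (init (tail t)) + x ^ p)) % p              ≡⟨ cong (_% p) (x∙yz≈y∙xz 1 _ (x ^ p)) ⟩
  (sum (init (tail t)) + (1 + x ^ p)) % p              ≡⟨ %-remove-+ˡ (1 + x ^ p) (∣-sum (init (tail t)) p∣inner-term) ⟩
  (1 + x ^ p) % p                                      ∎
  where
  open ≡-Reasoning
  p : ℕ
  p = suc n
  t : Vector ℕ (suc p)
  t k = (p C toℕ k) * (x ^ toℕ k * 1 ^ (p ∸ toℕ k))
  head-t : head t ≡ 1
  head-t = cong (λ y → 1 * (1 * y)) (^-zeroˡ p)
  last-t : last (tail t) ≡ x ^ p
  last-t = begin
    (p C suc (toℕ (fromℕ n))) * (x ^ suc (toℕ (fromℕ n)) * 1 ^ (n ∸ toℕ (fromℕ n)))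
      ≡⟨ cong (λ j → (p C suc j) * (x ^ suc j * 1 ^ (n ∸ j))) (toℕ-fromℕ n) ⟩
    (p C p) * (x ^ p * 1 ^ (n ∸ n))
      ≡⟨ cong₂ (λ c e → c * (x ^ p * 1 ^ e)) (nCn≡1 p) (n∸n≡0 n) ⟩
    1 * (x ^ p * 1)
      ≡⟨ trans (*-identityˡ _) (*-identityʳ (x ^ p)) ⟩
    x ^ p
      ∎
  p∣inner-term : ∀ j → p ∣ init (tail t) j
  p∣inner-term j = ∣m⇒∣m*n _ (prime∣C p-prime (inject₁ℕ< j))

x^p≡x : ∀ {n} → Prime (suc n) → ∀ x → x ^ suc n ≡ x [mod suc n ]
x^p≡x     p-prime zero    = refl
x^p≡x {n} p-prime (suc x) = begin
  suc x ^ suc n % suc n     ≡⟨ cong (λ y → y ^ suc n % suc n) (+-comm 1 x) ⟩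
  (x + 1) ^ suc n % suc n   ≡⟨ freshmans-dream p-prime x ⟩
  (1 + x ^ suc n) % suc n   ≡⟨ +-cong-mod {n} {1} {1} {x ^ suc n} {x} refl (x^p≡x p-prime x) ⟩
  suc x % suc n             ∎
  where open ≡-Reasoning

x^[p-1]≡1 : ∀ {n x} → Prime (suc n) → suc n ∤ x → x ^ n ≡ 1 [mod suc n ]
x^[p-1]≡1 {n} {x} p-prime p∤x = *-cancelˡ-mod {n} {x} {x ^ n} {1} p-prime p∤x
  (trans (x^p≡x p-prime x) (cong (_% suc n) (sym (*-identityʳ x))))

^-periodic : ∀ {m n x} → x ^ n ≡ 1 [mod suc m ] → ∀ r q → x ^ (r + q * n) ≡ x ^ r [mod suc m ]
^-periodic {m} {n} {x} xⁿ≡1 r q = begin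
  x ^ (r + q * n) % suc m     ≡⟨ cong (_% suc m) (^-distribˡ-+-* x r (q * n)) ⟩
  x ^ r * x ^ (q * n) % suc m ≡⟨ cong (λ y → x ^ r * y % suc m) ([x^m]^n≡x^[n*m] x n q) ⟨
  x ^ r * (x ^ n) ^ q % suc m ≡⟨ *-cong-mod {m} {x ^ r} {x ^ r} {(x ^ n) ^ q} {1 ^ q} refl (^-congˡ-mod xⁿ≡1 q) ⟩
  x ^ r * 1 ^ q % suc m       ≡⟨ cong (λ y → x ^ r * y % suc m) (^-zeroˡ q) ⟩
  x ^ r * 1 % suc m           ≡⟨ cong (_% suc m) (*-identityʳ (x ^ r)) ⟩
  x ^ r % suc m               ∎
  where open ≡-Reasoning

^-congʳ-mod : ∀ {m n x e f} → x ^ n ≡ 1 [mod suc m ] → e ≡ f [mod n ] → x ^ e ≡ x ^ f [mod suc m ]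
^-congʳ-mod {n = zero} _ refl = refl
^-congʳ-mod {m} {suc n} {x} {e} {f} xⁿ≡1 e≡f = begin
  x ^ e % suc m                               ≡⟨ cong (λ k → x ^ k % suc m) (m≡m%n+[m/n]*n e (suc n)) ⟩
  x ^ (e % suc n + e / suc n * suc n) % suc m ≡⟨ ^-periodic xⁿ≡1 (e % suc n) (e / suc n) ⟩
  x ^ (e % suc n) % suc m                     ≡⟨ cong (λ r → x ^ r % suc m) e≡f ⟩
  x ^ (f % suc n) % suc m                     ≡⟨ ^-periodic xⁿ≡1 (f % suc n) (f / suc n) ⟨
  x ^ (f % suc n + f / suc n * suc n) % suc m ≡⟨ cong (λ k → x ^ k % suc m) (m≡m%n+[m/n]*n f (suc n)) ⟨
  x ^ f % suc m                               ∎
  where open ≡-Reasoning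

-- The library's Bézout identity d + y b ≡ x a avoids subtraction; modulo m + 1 the
-- coefficient m y of b plays the role of − y.
bezout-identity⇒mod : ∀ {a b d} m x y → d + y * b ≡ x * a → x * a + y * m * b ≡ d [mod suc m ]
bezout-identity⇒mod {a} {b} {d} m x y d+yb≡xa = begin
  (x * a + y * m * b) % suc m ≡⟨ cong (_% suc m) regroup ⟩
  (d + y * b * suc m) % suc m ≡⟨ %-remove-+ʳ d (n∣m*n (y * b)) ⟩
  d % suc m                   ∎
  where
  open ≡-Reasoning
  regroup : x * a + y * m * b ≡ d + y * b * suc m
  regroup = begin
    x * a + y * m * b     ≡⟨ cong (_+ y * m * b) d+yb≡xa ⟨
    d + y * b + y * m * b ≡⟨ solve (d ∷ y ∷ b ∷ m ∷ []) ⟩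
    d + y * b * suc m     ∎

bezout-mod : ∀ a b m → ∃₂ λ u v → u * a + v * b ≡ gcd a b [mod suc m ]
bezout-mod a b m with Bézout.identity (gcd-GCD a b)
... | Bézout.+- x y d+yb≡xa = x , y * m , bezout-identity⇒mod m x y d+yb≡xa
... | Bézout.-+ x y d+xa≡yb = x * m , y ,
  trans (cong (_% suc m) (+-comm (x * m * a) (y * b))) (bezout-identity⇒mod m y x d+xa≡yb)

bezout-mod-unit : ∀ a b m → gcd (gcd a b) (suc m) ≡ 1 → ∃₂ λ u v → u * a + v * b ≡ 1 [mod suc m ]
bezout-mod-unit a b m gcd≡1 with bezout-mod a b m | bezout-mod (gcd a b) (suc m) m
... | U , V , Ua+Vb≡d | t , s , td+s[1+m]≡1 = t * U , t * V , (begin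
  (t * U * a + t * V * b) % suc m   ≡⟨ cong (_% suc m) regroup ⟩
  t * (U * a + V * b) % suc m       ≡⟨ *-cong-mod {m} {t} {t} {U * a + V * b} {gcd a b} refl Ua+Vb≡d ⟩
  t * gcd a b % suc m               ≡⟨ %-remove-+ʳ (t * gcd a b) (n∣m*n s) ⟨
  (t * gcd a b + s * suc m) % suc m ≡⟨ trans td+s[1+m]≡1 (cong (_% suc m) gcd≡1) ⟩
  1 % suc m                         ∎)
  where
  open ≡-Reasoning
  regroup : t * U * a + t * V * b ≡ t * (U * a + V * b)
  regroup = solve (t ∷ U ∷ a ∷ V ∷ b ∷ [])

Triple : ℕ → ℕ → ℕ → ℕ → Set
Triple p g h a = g ^ h ≡ a [mod p ] × g ^ a ≡ h [mod p ]

Triple⇒h^h≡a^a : ∀ {n g h a} → Triple (suc n) g h a → h ^ h ≡ a ^ a [mod suc n ]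
Triple⇒h^h≡a^a {n} {g} {h} {a} (gʰ≡a , gᵃ≡h) = begin
  h ^ h % suc n       ≡⟨ ^-congˡ-mod {n} {g ^ a} {h} gᵃ≡h h ⟨
  (g ^ a) ^ h % suc n ≡⟨ cong (_% suc n) ([x^m]^n≡[x^n]^m g a h) ⟩
  (g ^ h) ^ a % suc n ≡⟨ ^-congˡ-mod {n} {g ^ h} {a} gʰ≡a a ⟩
  a ^ a % suc n       ∎
  where open ≡-Reasoning

^≡∤⇒>0 : ∀ {n x k a} → 0 < k → suc n ∤ a → x ^ k ≡ a [mod suc n ] → 0 < x
^≡∤⇒>0 {x = zero}  {suc k} {a} _ p∤a 0≡a = contradiction (m%n≡0⇒n∣m a _ (sym 0≡a)) p∤a
^≡∤⇒>0 {x = suc x}                _ _   _   = z<s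

1≤x≤n⇒[1+n]∤x : ∀ {n x} → 1 ≤ x → x ≤ n → suc n ∤ x
1≤x≤n⇒[1+n]∤x 1≤x x≤n = >⇒∤ {{>-nonZero 1≤x}} (s≤s x≤n)

module _ {n h a u v : ℕ} (p-prime : Prime (suc n)) (uh+va≡1 : u * h + v * a ≡ 1 [mod n ]) where

  private
    p : ℕ
    p = suc n

  ^[uh+va]≡id : ∀ {x} → p ∤ x → x ^ (u * h + v * a) ≡ x [mod p ]
  ^[uh+va]≡id {x} p∤x =
    trans (^-congʳ-mod {x = x} (x^[p-1]≡1 p-prime p∤x) uh+va≡1) (cong (_% p) (*-identityʳ x))

  Triple⇒≡a^u*h^v : ∀ {x} → p ∤ x → Triple p x h a → x ≡ a ^ u * h ^ v [mod p ]
  Triple⇒≡a^u*h^v {x} p∤x (xʰ≡a , xᵃ≡h) = begin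
    x % p                         ≡⟨ ^[uh+va]≡id p∤x ⟨
    x ^ (u * h + v * a) % p       ≡⟨ cong (_% p) (x^[u*e+v*f]≡[x^e]^u*[x^f]^v x u v h a) ⟩
    (x ^ h) ^ u * (x ^ a) ^ v % p ≡⟨ *-cong-mod {n} {(x ^ h) ^ u} {a ^ u} {(x ^ a) ^ v} {h ^ v}
                                       (^-congˡ-mod {n} {x ^ h} {a} xʰ≡a u) (^-congˡ-mod {n} {x ^ a} {h} xᵃ≡h v) ⟩
    a ^ u * h ^ v % p             ∎
    where open ≡-Reasoning

  h^h≡a^a⇒Triple : p ∤ h → p ∤ a → h ^ h ≡ a ^ a [mod p ] → Triple p (a ^ u * h ^ v) h a
  h^h≡a^a⇒Triple p∤h p∤a hʰ≡aᵃ = gʰ≡a , gᵃ≡h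
    where
    open ≡-Reasoning
    gʰ≡a : (a ^ u * h ^ v) ^ h ≡ a [mod p ]
    gʰ≡a = begin
      (a ^ u * h ^ v) ^ h % p       ≡⟨ cong (_% p) ([y^u*z^v]^e≡[y^e]^u*[z^e]^v a h u v h) ⟩
      (a ^ h) ^ u * (h ^ h) ^ v % p ≡⟨ *-cong-mod {n} {(a ^ h) ^ u} {(a ^ h) ^ u} {(h ^ h) ^ v} {(a ^ a) ^ v}
                                         refl (^-congˡ-mod {n} {h ^ h} {a ^ a} hʰ≡aᵃ v) ⟩
      (a ^ h) ^ u * (a ^ a) ^ v % p ≡⟨ cong (_% p) (x^[u*e+v*f]≡[x^e]^u*[x^f]^v a u v h a) ⟨
      a ^ (u * h + v * a) % p       ≡⟨ ^[uh+va]≡id p∤a ⟩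
      a % p                         ∎
    gᵃ≡h : (a ^ u * h ^ v) ^ a ≡ h [mod p ]
    gᵃ≡h = begin
      (a ^ u * h ^ v) ^ a % p       ≡⟨ cong (_% p) ([y^u*z^v]^e≡[y^e]^u*[z^e]^v a h u v a) ⟩
      (a ^ a) ^ u * (h ^ a) ^ v % p ≡⟨ *-cong-mod {n} {(a ^ a) ^ u} {(h ^ h) ^ u} {(h ^ a) ^ v} {(h ^ a) ^ v}
                                         (^-congˡ-mod {n} {a ^ a} {h ^ h} (sym hʰ≡aᵃ) u) refl ⟩
      (h ^ h) ^ u * (h ^ a) ^ v % p ≡⟨ cong (_% p) (x^[u*e+v*f]≡[x^e]^u*[x^f]^v h u v h a) ⟨
      h ^ (u * h + v * a) % p       ≡⟨ ^[uh+va]≡id p∤h ⟩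
      h % p                         ∎

  Triple-unique : ∀ {g g′} → 1 ≤ g → g ≤ n → 1 ≤ g′ → g′ ≤ n → Triple p g h a → Triple p g′ h a → g ≡ g′
  Triple-unique 1≤g g≤n 1≤g′ g′≤n triple triple′ = ≡-mod⇒≡ g≤n g′≤n (trans
    (Triple⇒≡a^u*h^v (1≤x≤n⇒[1+n]∤x 1≤g g≤n) triple)
    (sym (Triple⇒≡a^u*h^v (1≤x≤n⇒[1+n]∤x 1≤g′ g′≤n) triple′)))

  Triple-exists : 1 ≤ h → h ≤ n → 1 ≤ a → a ≤ n → h ^ h ≡ a ^ a [mod p ] →
                  Σ ℕ (λ g → (1 ≤ g × g ≤ n) × Triple p g h a)
  Triple-exists 1≤h h≤n 1≤a a≤n hʰ≡aᵃ =
    g₀ % p , (^≡∤⇒>0 {n} {g₀ % p} {h} {a} 1≤h p∤a gʰ≡a , m<1+n⇒m≤n (m%n<n g₀ p)) , gʰ≡a , gᵃ≡h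
    where
    g₀ : ℕ
    g₀ = a ^ u * h ^ v
    p∤a : p ∤ a
    p∤a = 1≤x≤n⇒[1+n]∤x 1≤a a≤n
    g₀-triple : Triple p g₀ h a
    g₀-triple = h^h≡a^a⇒Triple (1≤x≤n⇒[1+n]∤x 1≤h h≤n) p∤a hʰ≡aᵃ
    gʰ≡a : (g₀ % p) ^ h ≡ a [mod p ]
    gʰ≡a = trans (^-congˡ-mod {n} {g₀ % p} {g₀} (m%n%n≡m%n g₀ p) h) (proj₁ g₀-triple)
    gᵃ≡h : (g₀ % p) ^ a ≡ h [mod p ]
    gᵃ≡h = trans (^-congˡ-mod {n} {g₀ % p} {g₀} (m%n%n≡m%n g₀ p) a) (proj₂ g₀-triple)

proposition7 : (p : ℕ) → Prime p →
    (h a : ℕ) → 1 ≤ h → h ≤ p ∸ 1 → 1 ≤ a → a ≤ p ∸ 1 →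
    gcd (gcd h a) (p ∸ 1) ≡ 1 →
      ((h ^ h ≡ a ^ a [mod p ] →
          Σ ℕ (λ g → (1 ≤ g × g ≤ p ∸ 1) × (g ^ h ≡ a [mod p ] × g ^ a ≡ h [mod p ])))
      × (Σ ℕ (λ g → (1 ≤ g × g ≤ p ∸ 1) × (g ^ h ≡ a [mod p ] × g ^ a ≡ h [mod p ])) →
          h ^ h ≡ a ^ a [mod p ]))
      × ((g g′ : ℕ) → 1 ≤ g → g ≤ p ∸ 1 → 1 ≤ g′ → g′ ≤ p ∸ 1 →
          g ^ h ≡ a [mod p ] → g ^ a ≡ h [mod p ] →
          g′ ^ h ≡ a [mod p ] → g′ ^ a ≡ h [mod p ] →
          g ≡ g′)
proposition7 zero          p-prime = contradiction p-prime ¬prime[0]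
proposition7 (suc zero)    p-prime = contradiction p-prime ¬prime[1]
proposition7 (suc (suc m)) p-prime h a 1≤h h≤p-1 1≤a a≤p-1 gcd≡1 =
  let (u , v , uh+va≡1) = bezout-mod-unit h a m gcd≡1 in
  ( Triple-exists {u = u} {v = v} p-prime uh+va≡1 1≤h h≤p-1 1≤a a≤p-1
  , λ (g , _ , triple) → Triple⇒h^h≡a^a {g = g} {h} {a} triple )
  , λ g g′ 1≤g g≤p-1 1≤g′ g′≤p-1 gʰ≡a gᵃ≡h g′ʰ≡a g′ᵃ≡h →
      Triple-unique {h = h} {a} {u} {v} p-prime uh+va≡1 1≤g g≤p-1 1≤g′ g′≤p-1 (gʰ≡a , gᵃ≡h) (g′ʰ≡a , g′ᵃ≡h)
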